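{- Let $X=\{0,1,\dots,6\}$ and let $\mathcal{B}$ consist of the 14 transitive triples $(0,4,2), (0,5,6), (1,3,0), (1,5,2), (2,0,1), (2,6,5), (3,1,6), (3,2,4), (4,3,5), (4,6,1), (5,0,3), (5,1,4), (6,2,3), (6,4,0)$. Then $(X,\mathcal{B})$ is a DTS$(7)$ that does not have a $7$-good sequencing.
   Context: A transitive triple is an ordered triple $(x,y,z)$ of distinct elements; it contains the directed edges $(x,y)$, $(x,z)$, $(y,z)$. A directed triple system of order $v$, DTS$(v)$, is a pair $(X,\mathcal{B})$ where $X$ is a set of $v$ points and $\mathcal{B}$ is a set of transitive triples of elements of $X$ such that every ordered pair $(a,b)$ of distinct points of $X$ occurs as a directed edge in exactly one triple of $\mathcal{B}$. A $v$-good sequencing of a DTS$(v)$ $(X,\mathcal{B})$ is a permutation $[x_1\, x_2\, \cdots\, x_v]$ of $X$ such that for no triple $(x,y,z)\in\mathcal{B}$ do we have $x=x_i$, $y=x_j$, $z=x_k$ with $i<j<k$. -}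

module Defs where

open import Data.Nat using (ℕ)
open import Data.Fin using (Fin; _<_)
open import Data.Fin.Patterns
open import Data.Product using (_×_; _,_; ∃; Σ)
open import Data.Sum using (_⊎_)
open import Data.List using (List; _∷_; []; filter; length)
open import Data.List.Membership.Propositional using (_∈_)
open import Data.List.Relation.Unary.All using (All)
open import Data.List.Relation.Unary.Unique.Propositional using (Unique)
open import Relation.Binary.PropositionalEquality using (_≡_; _≢_)
open import Function.Bundles using (_↔_; Inverse)

Triple : ℕ → Set
Triple v = Fin v × Fin v × Fin v

Distinct : ∀ {v} → Triple v → Set
Distinct (x , y , z) = x ≢ y × x ≢ z × y ≢ z

EdgeIn : ∀ {v} → Fin v → Fin v → Triple v → Set
EdgeIn a b (x , y , z) = (a ≡ x × b ≡ y) ⊎ (a ≡ x × b ≡ z) ⊎ (a ≡ y × b ≡ z)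

ExactlyOne : ∀ {v} → Fin v → Fin v → List (Triple v) → Set
ExactlyOne a b B =
  (∃ λ t → t ∈ B × EdgeIn a b t) ×
  (∀ {t s} → t ∈ B → s ∈ B → EdgeIn a b t → EdgeIn a b s → t ≡ s)

IsDTS : (v : ℕ) → List (Triple v) → Set
IsDTS v B =
  Unique B ×
  All Distinct B ×
  (∀ (a b : Fin v) → a ≢ b → ExactlyOne a b B)

-- A sequencing is a bijection σ : positions → points, σ i = x_{i+1}.
-- It is v-good if no triple (x,y,z) ∈ B has x = σ i, y = σ j, z = σ k with i<j<k.
IsGoodSequencing : (v : ℕ) → List (Triple v) → (Fin v ↔ Fin v) → Set
IsGoodSequencing v B σ =
  ∀ {x y z} → (x , y , z) ∈ B →
  ∀ (i j k : Fin v) → i < j → j < k →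
  Inverse.to σ i ≡ x → Inverse.to σ j ≡ y → Inverse.to σ k ≡ z → ⊥'
  where open import Data.Empty renaming (⊥ to ⊥')

HasGoodSequencing : (v : ℕ) → List (Triple v) → Set
HasGoodSequencing v B = ∃ λ σ → IsGoodSequencing v B σ

B7 : List (Triple 7)
B7 = (0F , 4F , 2F) ∷ (0F , 5F , 6F) ∷ (1F , 3F , 0F) ∷ (1F , 5F , 2F) ∷
     (2F , 0F , 1F) ∷ (2F , 6F , 5F) ∷ (3F , 1F , 6F) ∷ (3F , 2F , 4F) ∷
     (4F , 3F , 5F) ∷ (4F , 6F , 1F) ∷ (5F , 0F , 3F) ∷ (5F , 1F , 4F) ∷
     (6F , 2F , 3F) ∷ (6F , 4F , 0F) ∷ []

-- Once a point a is placed first, a triple (a , y , z) is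
-- reduced to the pair (y , z), which must not occur among the remaining
-- points, and no other triple through a can occur any more.  Recursing on the
-- remaining points gives a finite tree of choices, and every branch of it
-- completes a triple of B7.  The DTS axioms for B7 are decided by computation.
module Submission where

open import Defs
open import Data.Nat using (ℕ; zero; suc) renaming (_<_ to _<ℕ_; _≤_ to _≤ℕ_)
open import Data.Nat.Properties using (≤∧≢⇒<)
open import Data.Fin using (Fin; toℕ; _≟_)
open import Data.Fin.Properties using (all?; toℕ-injective)
open import Data.Product using (_×_; _,_; ∃; proj₁)
open import Data.Product.Properties using (≡-dec)
open import Data.Sum using (_⊎_; inj₁; inj₂)
open import Data.Maybe using (Maybe; just; nothing; from-just)
import Data.Maybe as Maybe
import Data.List.Properties as List
open import Data.List using (List; []; _∷_; [_]; filter; map; allFin)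
open import Data.List.Membership.Propositional using (_∈_)
open import Data.List.Membership.Propositional.Properties
  using (∈-filter⁺; ∈-filter⁻; ∈-map⁻)
open import Data.List.Relation.Unary.Any using (here; there)
open import Data.List.Relation.Unary.All as All using (All; []; _∷_)
open import Data.List.Relation.Unary.Linked as Linked using (Linked; _∷_)
open import Data.List.Extrema.Nat using (argmin; argmin-sel; f[argmin]≤f[⊤]; f[argmin]≤f[xs])
import Data.List.Relation.Unary.Unique.DecPropositional as Unique
open import Function using (_∘_)
open import Function.Bundles using (_↔_; Inverse; Injection)
open import Function.Properties.Inverse using (↔⇒↣)
open import Function.Construct.Symmetry using (↔-sym)
open import Function.Definitions using (Injective)
open import Relation.Binary.Definitions using (DecidableEquality)
open import Relation.Binary.PropositionalEquality using (_≡_; _≢_; refl; sym; trans; subst)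
open import Relation.Nullary using (¬_; Dec; yes; no; ¬?; contradiction)
open import Relation.Nullary.Decidable using (from-yes; _×-dec_; _⊎-dec_)
open import Relation.Unary using (Decidable)

edgeIn? : ∀ {v} (a b : Fin v) → Decidable (EdgeIn a b)
edgeIn? a b (x , y , z) =
  (a ≟ x ×-dec b ≟ y) ⊎-dec (a ≟ x ×-dec b ≟ z) ⊎-dec (a ≟ y ×-dec b ≟ z)

distinct? : ∀ {v} → Decidable (Distinct {v})
distinct? (x , y , z) = ¬? (x ≟ y) ×-dec ¬? (x ≟ z) ×-dec ¬? (y ≟ z)

_≟ᵗ_ : ∀ {v} → DecidableEquality (Triple v)
_≟ᵗ_ = ≡-dec _≟_ (≡-dec _≟_ _≟_)

Singleton : ∀ {A : Set} → List A → Set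
Singleton {A} xs = ∃ λ (x : A) → xs ≡ [ x ]

singleton? : ∀ {A : Set} → Decidable (Singleton {A})
singleton? []           = no λ ()
singleton? (x ∷ [])     = yes (x , refl)
singleton? (_ ∷ _ ∷ _)  = no λ ()

singleton-filter⇒exactlyOne : ∀ {v} {a b : Fin v} (B : List (Triple v)) →
                              Singleton (filter (edgeIn? a b) B) → ExactlyOne a b B
singleton-filter⇒exactlyOne {a = a} {b} B (t , matches≡[t]) =
  (t , ∈-filter⁻ (edgeIn? a b) t∈matches) , λ s∈B r∈B e₁ e₂ → trans (uniq s∈B e₁) (sym (uniq r∈B e₂))
  where
  t∈matches : t ∈ filter (edgeIn? a b) B
  t∈matches = subst (t ∈_) (sym matches≡[t]) (here refl)
  uniq : ∀ {s} → s ∈ B → EdgeIn a b s → s ≡ t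
  uniq s∈B e with subst (_ ∈_) matches≡[t] (∈-filter⁺ (edgeIn? a b) s∈B e)
  ... | here s≡t = s≡t

isDTS-B7 : IsDTS 7 B7
isDTS-B7 = from-yes (Unique.unique? _≟ᵗ_ B7) , from-yes (All.all? distinct? B7) , exactlyOne
  where
  hasUniqueMatch : ∀ (a b : Fin 7) → Dec (a ≡ b ⊎ Singleton (filter (edgeIn? a b) B7))
  hasUniqueMatch a b = a ≟ b ⊎-dec singleton? (filter (edgeIn? a b) B7)
  exactlyOne : ∀ (a b : Fin 7) → a ≢ b → ExactlyOne a b B7
  exactlyOne a b a≢b with from-yes (all? λ a → all? λ b → hasUniqueMatch a b) a b
  ... | inj₁ a≡b    = contradiction a≡b a≢b
  ... | inj₂ unique = singleton-filter⇒exactlyOne B7 unique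

module Patterns {A : Set} (_≟ₐ_ : DecidableEquality A) where

  open import Data.List.Membership.DecPropositional (List.≡-dec _≟ₐ_) using (_∈?_)

  Increasing : (A → ℕ) → List A → Set
  Increasing f = Linked (λ a b → f a <ℕ f b)

  _∖_ : List A → A → List A
  S ∖ a = filter (¬? ∘ (a ≟ₐ_)) S

  derivative : A → List A → List A
  derivative a []      = []
  derivative a (b ∷ q) with a ≟ₐ b
  ... | yes _ = q
  ... | no  _ = b ∷ q

  -- Unavoidable S P: every ordering of S contains a pattern of P as a
  -- subsequence.  derivative a q is what remains of q once a is placed first;
  -- patterns through a at a later position are kept, but can no longer complete.
  data Unavoidable : List A → List (List A) → Set where
    completed : ∀ {S P} → [] ∈ P → Unavoidable S P
    branch    : ∀ {x xs P} →
                (∀ {a} → a ∈ x ∷ xs → Unavoidable ((x ∷ xs) ∖ a) (map (derivative a) P)) →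
                Unavoidable (x ∷ xs) P

  allJust : {Q : A → Set} → (∀ a → Maybe (Q a)) → ∀ xs → Maybe (All Q xs)
  allJust f []       = just []
  allJust f (x ∷ xs) = Maybe.zipWith _∷_ (f x) (allJust f xs)

  -- Fuel length S suffices.
  unavoidable? : ℕ → ∀ S P → Maybe (Unavoidable S P)
  unavoidable? fuel S P with [] ∈? P
  ... | yes []∈P = just (completed []∈P)
  unavoidable? zero       S        P | no _ = nothing
  unavoidable? (suc fuel) []       P | no _ = nothing
  unavoidable? (suc fuel) (x ∷ xs) P | no _ =
    Maybe.map (branch ∘ All.lookup) (allJust residual (x ∷ xs))
    where
    residual : ∀ a → Maybe (Unavoidable ((x ∷ xs) ∖ a) (map (derivative a) P))
    residual a = unavoidable? fuel ((x ∷ xs) ∖ a) (map (derivative a) P)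

  Occurrence : (A → ℕ) → List A → List (List A) → Set
  Occurrence p S P = ∃ λ q → q ∈ P × All (_∈ S) q × Increasing p q

  module _ {p : A → ℕ} (p-injective : Injective _≡_ _≡_ p) where

    ∷-increasing : ∀ {a q} → All (λ b → p a <ℕ p b) q → Increasing p q → Increasing p (a ∷ q)
    ∷-increasing []          _   = Linked.[-]
    ∷-increasing (pa<pb ∷ _) inc = pa<pb ∷ inc

    occurrence-derivative : ∀ {a S} → a ∈ S → ∀ q →
                            All (λ b → p a <ℕ p b) (derivative a q) →
                            All (_∈ S) (derivative a q) → Increasing p (derivative a q) →
                            All (_∈ S) q × Increasing p q
    occurrence-derivative a∈S []      _     _   _   = [] , Linked.[]
    occurrence-derivative {a} a∈S (b ∷ q) after inS inc with a ≟ₐ b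
    ... | yes refl = a∈S ∷ inS , ∷-increasing after inc
    ... | no  _    = inS , inc

    occurrence-residual : ∀ {a S P} → a ∈ S → All (λ b → p a ≤ℕ p b) S →
                          Occurrence p (S ∖ a) (map (derivative a) P) → Occurrence p S P
    occurrence-residual {a} {S} a∈S minimal (q′ , q′∈P′ , q′⊆S∖a , inc′)
      with ∈-map⁻ (derivative a) q′∈P′
    ... | q , q∈P , refl =
      q , q∈P , occurrence-derivative a∈S q (All.map after q′⊆S∖a) (All.map (proj₁ ∘ ∈-filter⁻ _) q′⊆S∖a) inc′
      where
      after : ∀ {b} → b ∈ S ∖ a → p a <ℕ p b
      after b∈S∖a with ∈-filter⁻ (¬? ∘ (a ≟ₐ_)) b∈S∖a
      ... | b∈S , a≢b = ≤∧≢⇒< (All.lookup minimal b∈S) (a≢b ∘ p-injective)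

    unavoidable⇒occurrence : ∀ {S P} → Unavoidable S P → Occurrence p S P
    unavoidable⇒occurrence (completed []∈P) = [] , []∈P , [] , Linked.[]
    unavoidable⇒occurrence (branch {x} {xs} next) =
      occurrence-residual m∈S minimal (unavoidable⇒occurrence (next m∈S))
      where
      m = argmin p x xs
      m∈S : m ∈ x ∷ xs
      m∈S with argmin-sel p x xs
      ... | inj₁ m≡x  = here m≡x
      ... | inj₂ m∈xs = there m∈xs
      minimal : All (λ b → p m ≤ℕ p b) (x ∷ xs)
      minimal = f[argmin]≤f[⊤] {f = p} x xs ∷ f[argmin]≤f[xs] {f = p} x xs

open module FinPatterns {v} = Patterns (_≟_ {v})

toPattern : ∀ {v} → Triple v → List (Fin v)
toPattern (x , y , z) = x ∷ y ∷ z ∷ []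

position-injective : ∀ {v} (σ : Fin v ↔ Fin v) → Injective _≡_ _≡_ (toℕ ∘ Inverse.from σ)
position-injective σ = Injection.injective (↔⇒↣ (↔-sym σ)) ∘ toℕ-injective

unavoidable⇒¬hasGoodSequencing : ∀ {v} (B : List (Triple v)) →
                                 Unavoidable (allFin v) (map toPattern B) → ¬ HasGoodSequencing v B
unavoidable⇒¬hasGoodSequencing B unavoidable (σ , good)
  with unavoidable⇒occurrence (position-injective σ) unavoidable
... | _ , t∈P , _ , increasing with ∈-map⁻ toPattern t∈P
... | (x , y , z) , t∈B , refl =
  good t∈B (from x) (from y) (from z) (Linked.head increasing) (Linked.head (Linked.tail increasing))
       (strictlyInverseˡ x) (strictlyInverseˡ y) (strictlyInverseˡ z)
  where open Inverse σ

theorem4p1 : IsDTS 7 B7 × ¬ HasGoodSequencing 7 B7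
theorem4p1 =
  isDTS-B7 ,
  unavoidable⇒¬hasGoodSequencing B7 (from-just (unavoidable? 7 (allFin 7) (map toPattern B7)))
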